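{- In the tentative schedule $\sigma_{temp}$, every request has flow time at most $L^*$; that is, for each request $\rho$, page $p_\rho$ is transmitted in $\sigma_{temp}$ at some time in $[r_\rho+1,r_\rho+L^*]$.
   Context: Broadcast scheduling (maximum flow time): pages $\mathcal{P}$; requests $\rho$ with non-negative integer release times $r_\rho$ and pages $p_\rho$; $L^*$ is the optimal maximum flow time; $\mathcal{T}_p$ is the set of release times of requests for page $p$; time horizon $[1,T]$. Standing assumption: any two requests for the same page with no request for that page released strictly between them have release times differing by at most $L^*-1$. Let $x^*_{p,t}\ge0$ ($p\in\mathcal{P}$, $t\in[T]$) be a solution of the LP: $\sum_{t'=t+1}^{t+L^*}x_{p,t'}\ge1$ for all $p$ and $t\in\mathcal{T}_p$; $\sum_p x_{p,t}\le1$ for all $t\in[T]$; $x_{p,t}=0$ for $t\notin W_p:=[\min\mathcal{T}_p+1,\max\mathcal{T}_p+L^*]$. Let $\mathcal{G}$ be a partition of $\mathcal{P}$ into groups such that distinct pages in the same group have disjoint windows $W_p$. For each group $g$ let $y^*_{g,t}:=\sum_{p\in g}\sum_{t'\le t}x^*_{p,t'}$ and pick $\alpha_g\in[0,1]$ uniformly at random, independently over groups. In $\sigma_{temp}$ (which may transmit several pages at one time), for each group $g$ and each time $t$ such that $y^*_{g,t-1}<k+\alpha_g\le y^*_{g,t}$ for some integer $k$, the (unique) page $p\in g$ with $x^*_{p,t}>0$ is transmitted at time $t$. Flow time of $\rho$ in $\sigma_{temp}$ is the first transmission time of $p_\rho$ after $r_\rho$ minus $r_\rho$.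
   Formalization: The LP solution $x^*_{p,t}$ and the group offsets $\alpha_g\in[0,1]$ take only rational values. -}

module Defs where

open import Data.Nat using (ℕ; zero; suc; _≤_; _<_; _+_)
open import Data.Fin using (Fin; zero; suc)
open import Data.Integer using (ℤ)
open import Data.Rational using (ℚ; 0ℚ; 1ℚ; _/_) renaming (_+_ to _+q_; _<_ to _<q_; _≤_ to _≤q_)
open import Data.Maybe using (Maybe; just; nothing)
open import Data.Product using (Σ; ∃; ∃-syntax; _×_; _,_)
open import Relation.Binary.PropositionalEquality using (_≡_; _≢_)
open import Relation.Nullary using (¬_)
open import Relation.Nullary.Decidable using (does)
open import Data.Fin using (_≟_)
open import Data.Bool using (if_then_else_)
open import Data.Sum using (_⊎_)
open import Data.Empty using (⊥)

sumFin : (n : ℕ) → (Fin n → ℚ) → ℚ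
sumFin zero    f = 0ℚ
sumFin (suc n) f = f zero +q sumFin n (λ i → f (suc i))

sumFinIn : {n m : ℕ} → (Fin n → Fin m) → Fin m → (Fin n → ℚ) → ℚ
sumFinIn {n} grp g f = sumFin n (λ p → if does (grp p ≟ g) then f p else 0ℚ)

sumTo : (ℕ → ℚ) → ℕ → ℚ
sumTo f zero    = 0ℚ
sumTo f (suc t) = sumTo f t +q f (suc t)

sumRange : (ℕ → ℚ) → ℕ → ℕ → ℚ
sumRange f a zero    = 0ℚ
sumRange f a (suc l) = f (suc a) +q sumRange f (suc a) l

ℤ→ℚ : ℤ → ℚ
ℤ→ℚ k = k / 1

Schedule : ℕ → Set
Schedule nP = ℕ → Maybe (Fin nP)

ServedWithin : {nP nR : ℕ} → (Fin nR → Fin nP) → (Fin nR → ℕ) →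
               Schedule nP → ℕ → Fin nR → Set
ServedWithin page rel σ L ρ =
  ∃[ t ] (rel ρ < t × t ≤ rel ρ + L × σ t ≡ just (page ρ))

FeasibleMaxFlow : {nP nR : ℕ} → (Fin nR → Fin nP) → (Fin nR → ℕ) → ℕ → Set
FeasibleMaxFlow {nP} page rel L =
  ∃[ σ ] (∀ ρ → ServedWithin page rel σ L ρ)

IsOptMaxFlow : {nP nR : ℕ} → (Fin nR → Fin nP) → (Fin nR → ℕ) → ℕ → Set
IsOptMaxFlow page rel L =
  FeasibleMaxFlow page rel L × (∀ L′ → FeasibleMaxFlow page rel L′ → L ≤ L′)

ConsecutiveGap : {nP nR : ℕ} → (Fin nR → Fin nP) → (Fin nR → ℕ) → ℕ → Set
ConsecutiveGap page rel L =
  ∀ ρ ρ′ → page ρ ≡ page ρ′ → rel ρ ≤ rel ρ′ →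
  (¬ (∃[ ρ″ ] (page ρ″ ≡ page ρ × rel ρ < rel ρ″ × rel ρ″ < rel ρ′))) →
  rel ρ′ + 1 ≤ rel ρ + L

-- t ∈ W_p = [min T_p + 1, max T_p + L]  (empty if p has no requests)
InWindow : {nP nR : ℕ} → (Fin nR → Fin nP) → (Fin nR → ℕ) → ℕ →
           Fin nP → ℕ → Set
InWindow page rel L p t =
  ∃[ ρ ] ∃[ ρ′ ] (page ρ ≡ p × page ρ′ ≡ p × rel ρ + 1 ≤ t × t ≤ rel ρ′ + L)

-- x : Fin nP → ℕ → ℚ is a feasible LP solution (x p t for t ∈ [1,T];
-- extended by 0 outside [1,T]).
LPFeasible : {nP nR : ℕ} → (Fin nR → Fin nP) → (Fin nR → ℕ) → ℕ → ℕ →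
             (Fin nP → ℕ → ℚ) → Set
LPFeasible {nP} page rel L T x =
    (∀ p t → 0ℚ ≤q x p t)
  × (∀ p t → (t ≡ 0 ⊎ T < t) → x p t ≡ 0ℚ)
  × (∀ ρ → 1ℚ ≤q sumRange (x (page ρ)) (rel ρ) L)
  × (∀ t → 1 ≤ t → t ≤ T → sumFin nP (λ p → x p t) ≤q 1ℚ)
  × (∀ p t → 1 ≤ t → t ≤ T → ¬ InWindow page rel L p t → x p t ≡ 0ℚ)

GroupsDisjoint : {nP nR nG : ℕ} → (Fin nR → Fin nP) → (Fin nR → ℕ) → ℕ →
                 (Fin nP → Fin nG) → Set
GroupsDisjoint page rel L grp =
  ∀ p q → grp p ≡ grp q → p ≢ q → ∀ t →
  ¬ (InWindow page rel L p t × InWindow page rel L q t)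

yStar : {nP nG : ℕ} → (Fin nP → Fin nG) → (Fin nP → ℕ → ℚ) → Fin nG → ℕ → ℚ
yStar grp x g t = sumFinIn grp g (λ p → sumTo (x p) t)

TempTransmits : {nP nG : ℕ} → (Fin nP → Fin nG) → (Fin nP → ℕ → ℚ) →
                (Fin nG → ℚ) → Fin nP → ℕ → Set
TempTransmits grp x α p zero    = ⊥
TempTransmits grp x α p (suc t) =
  (∃[ k ] (yStar grp x (grp p) t <q ℤ→ℚ k +q α (grp p)
          × ℤ→ℚ k +q α (grp p) ≤q yStar grp x (grp p) (suc t)))
  × 0ℚ <q x p (suc t)

-- In the window (r, r + L] of a request for page p, every other page of the
-- group of p has no LP mass, since its window is disjoint from that of p.
-- So there y*_g grows exactly by x*_p, and by the covering constraint it gains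
-- at least 1 over the window. Every interval (y, y + 1] contains a point
-- k + α_g, so y*_g crosses such a point at some t in the window; the crossing
-- step has x*_{p,t} > 0, hence p is the page transmitted at t.
module Submission where

open import Defs
open import Data.Nat using (ℕ; _<_; _≤_; _+_)
open import Data.Fin using (Fin)
open import Data.Rational using (ℚ; 0ℚ; 1ℚ) renaming (_≤_ to _≤q_)
open import Data.Product using (∃-syntax; _×_)

import Data.Rational.Properties as ℚP
open import Algebra.Properties.Group ℚP.+-0-group using (//-rightDividesˡ)
open import Algebra.Properties.CommutativeMonoid.Sum ℚP.+-0-commutativeMonoid
  using (sum; ∑-distrib-+)
open import Data.Bool using (if_then_else_)
open import Data.Empty using (⊥-elim)
open import Data.Fin using (zero; suc) renaming (_≟_ to _≟F_)
open import Data.Fin.Properties using (suc-injective)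
open import Data.Integer as ℤ using (ℤ; +_)
open import Data.Integer.DivMod using (_/ℕ_; [n/ℕd]*d≤n; n<s[n/ℕd]*d)
import Data.Integer.Properties as ℤP
open import Data.Nat using (zero; suc; s≤s; z≤n; _≤?_)
import Data.Nat.Properties as ℕP
open import Data.Product using (_,_; proj₁; proj₂)
open import Data.Rational using (mkℚ; toℚᵘ; _-_) renaming (_+_ to _+q_; _<_ to _<q_)
import Data.Rational.Unnormalised as ℚᵘ
import Data.Rational.Unnormalised.Properties as ℚᵘP
open import Data.Sum using (_⊎_; inj₂)
open import Function using (_∘_)
open import Relation.Binary.PropositionalEquality
open import Relation.Nullary using (¬_; yes; no; does)

∃-integer-in-unit-interval : ∀ z → ∃[ k ] (z <q ℤ→ℚ k × ℤ→ℚ k ≤q z +q 1ℚ)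
∃-integer-in-unit-interval z@(mkℚ n d _) = k , z<k , k≤z+1
  where
  q k : ℤ
  q = n /ℕ suc d
  k = ℤ.suc q

  ℤ→ℚᵘ : ∀ j → toℚᵘ (ℤ→ℚ j) ℚᵘ.≃ ℚᵘ.mkℚᵘ j 0
  ℤ→ℚᵘ j = ℚP.toℚᵘ-fromℚᵘ (ℚᵘ.mkℚᵘ j 0)

  k≃q+1 : ℚᵘ.mkℚᵘ k 0 ℚᵘ.≃ ℚᵘ.mkℚᵘ q 0 ℚᵘ.+ ℚᵘ.1ℚᵘ
  k≃q+1 = ℚᵘ.*≡* (trans (ℤP.*-identityʳ k) (trans (ℤP.+-comm (+ 1) q)
            (sym (trans (ℤP.*-identityʳ _) (cong (ℤ._+ + 1) (ℤP.*-identityʳ q))))))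

  n<k*d : n ℤ.* + 1 ℤ.< k ℤ.* + suc d
  n<k*d = subst (ℤ._< k ℤ.* + suc d) (sym (ℤP.*-identityʳ n)) (n<s[n/ℕd]*d n (suc d))

  q*d≤n : q ℤ.* + suc d ℤ.≤ n ℤ.* + 1
  q*d≤n = subst (q ℤ.* + suc d ℤ.≤_) (sym (ℤP.*-identityʳ n)) ([n/ℕd]*d≤n n (suc d))

  z<k : z <q ℤ→ℚ k
  z<k = ℚP.toℚᵘ-cancel-< (ℚᵘP.<-respʳ-≃ (ℚᵘP.≃-sym (ℤ→ℚᵘ k)) (ℚᵘ.*<* n<k*d))

  k≤z+1 : ℤ→ℚ k ≤q z +q 1ℚ
  k≤z+1 = ℚP.toℚᵘ-cancel-≤ (ℚᵘP.≤-respʳ-≃ (ℚᵘP.≃-sym (ℚP.toℚᵘ-homo-+ z 1ℚ))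
            (ℚᵘP.≤-respˡ-≃ (ℚᵘP.≃-sym (ℚᵘP.≃-trans (ℤ→ℚᵘ k) k≃q+1))
              (ℚᵘP.+-monoˡ-≤ ℚᵘ.1ℚᵘ {ℚᵘ.mkℚᵘ q 0} {ℚᵘ.mkℚᵘ n d} (ℚᵘ.*≤* q*d≤n))))

∃-shifted-integer-in-unit-interval :
  ∀ a α → ∃[ k ] (a <q ℤ→ℚ k +q α × ℤ→ℚ k +q α ≤q a +q 1ℚ)
∃-shifted-integer-in-unit-interval a α with ∃-integer-in-unit-interval (a - α)
... | k , a-α<k , k≤a-α+1 =
  k , subst (_<q ℤ→ℚ k +q α) (//-rightDividesˡ α a) (ℚP.+-monoˡ-< α a-α<k)
    , ℚP.≤-trans (ℚP.+-monoˡ-≤ α k≤a-α+1) (ℚP.≤-reflexive a-α+1+α≡a+1)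
  where
  open ≡-Reasoning
  a-α+1+α≡a+1 : (a - α) +q 1ℚ +q α ≡ a +q 1ℚ
  a-α+1+α≡a+1 = begin
    (a - α) +q 1ℚ +q α   ≡⟨ ℚP.+-assoc (a - α) 1ℚ α ⟩
    (a - α) +q (1ℚ +q α) ≡⟨ cong ((a - α) +q_) (ℚP.+-comm 1ℚ α) ⟩
    (a - α) +q (α +q 1ℚ) ≡⟨ ℚP.+-assoc (a - α) α 1ℚ ⟨
    (a - α) +q α +q 1ℚ   ≡⟨ cong (_+q 1ℚ) (//-rightDividesˡ α a) ⟩
    a +q 1ℚ              ∎

crossing⇒0<increment : ∀ a b c → a <q c → c ≤q a +q b → 0ℚ <q b
crossing⇒0<increment a b c a<c c≤a+b with 0ℚ ℚP.<? b
... | yes 0<b = 0<b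
... | no 0≮b = ⊥-elim (ℚP.<-irrefl refl (ℚP.<-≤-trans a<c (ℚP.≤-trans c≤a+b a+b≤a)))
  where
  a+b≤a : a +q b ≤q a
  a+b≤a = ℚP.≤-trans (ℚP.+-monoʳ-≤ a (ℚP.≮⇒≥ 0≮b)) (ℚP.≤-reflexive (ℚP.+-identityʳ a))

sumFin≡sum : ∀ n (f : Fin n → ℚ) → sumFin n f ≡ sum f
sumFin≡sum zero    f = refl
sumFin≡sum (suc n) f = cong (f zero +q_) (sumFin≡sum n (f ∘ suc))

sumFin-cong : ∀ n {f h : Fin n → ℚ} → (∀ i → f i ≡ h i) → sumFin n f ≡ sumFin n h
sumFin-cong zero    f≡h = refl
sumFin-cong (suc n) f≡h = cong₂ _+q_ (f≡h zero) (sumFin-cong n (f≡h ∘ suc))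

sumFin-distrib-+ : ∀ n (f h : Fin n → ℚ) →
  sumFin n (λ i → f i +q h i) ≡ sumFin n f +q sumFin n h
sumFin-distrib-+ n f h = begin
  sumFin n (λ i → f i +q h i) ≡⟨ sumFin≡sum n _ ⟩
  sum (λ i → f i +q h i)      ≡⟨ ∑-distrib-+ f h ⟩
  sum f +q sum h              ≡⟨ cong₂ _+q_ (sumFin≡sum n f) (sumFin≡sum n h) ⟨
  sumFin n f +q sumFin n h    ∎
  where open ≡-Reasoning

sumFin-zero : ∀ n (f : Fin n → ℚ) → (∀ i → f i ≡ 0ℚ) → sumFin n f ≡ 0ℚ
sumFin-zero zero    f f≡0 = refl
sumFin-zero (suc n) f f≡0 = cong₂ _+q_ (f≡0 zero) (sumFin-zero n (f ∘ suc) (f≡0 ∘ suc))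

sumFin-single : ∀ n (f : Fin n → ℚ) p → (∀ i → i ≢ p → f i ≡ 0ℚ) → sumFin n f ≡ f p
sumFin-single (suc n) f zero f≡0 = begin
  f zero +q sumFin n (f ∘ suc) ≡⟨ cong (f zero +q_) (sumFin-zero n (f ∘ suc) (λ i → f≡0 (suc i) λ ())) ⟩
  f zero +q 0ℚ                 ≡⟨ ℚP.+-identityʳ (f zero) ⟩
  f zero                       ∎
  where open ≡-Reasoning
sumFin-single (suc n) f (suc p) f≡0 = begin
  f zero +q sumFin n (f ∘ suc) ≡⟨ cong (_+q sumFin n (f ∘ suc)) (f≡0 zero λ ()) ⟩
  0ℚ +q sumFin n (f ∘ suc)     ≡⟨ ℚP.+-identityˡ _ ⟩
  sumFin n (f ∘ suc)           ≡⟨ sumFin-single n (f ∘ suc) p (λ i i≢p → f≡0 (suc i) (i≢p ∘ suc-injective)) ⟩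
  f (suc p)                    ∎
  where open ≡-Reasoning

telescope : (y f : ℕ → ℚ) → ∀ l a → (∀ t → a ≤ t → t < a + l → y (suc t) ≡ y t +q f (suc t)) →
            y (a + l) ≡ y a +q sumRange f a l
telescope y f zero    a step = trans (cong y (ℕP.+-identityʳ a)) (sym (ℚP.+-identityʳ (y a)))
telescope y f (suc l) a step = begin
  y (a + suc l)                               ≡⟨ cong y (ℕP.+-suc a l) ⟩
  y (suc a + l)                               ≡⟨ telescope y f l (suc a) step′ ⟩
  y (suc a) +q sumRange f (suc a) l           ≡⟨ cong (_+q sumRange f (suc a) l) (step a ℕP.≤-refl (ℕP.m<m+n a (s≤s z≤n))) ⟩
  (y a +q f (suc a)) +q sumRange f (suc a) l  ≡⟨ ℚP.+-assoc (y a) (f (suc a)) _ ⟩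
  y a +q sumRange f a (suc l)                 ∎
  where
  open ≡-Reasoning
  step′ : ∀ t → suc a ≤ t → t < suc a + l → y (suc t) ≡ y t +q f (suc t)
  step′ t a<t t<a+1+l = step t (ℕP.<⇒≤ a<t) (subst (t <_) (sym (ℕP.+-suc a l)) t<a+1+l)

crossing : (y : ℕ → ℚ) (c : ℚ) → ∀ l a → y a <q c → c ≤q y (a + l) →
  ∃[ t ] (a ≤ t × t < a + l × y t <q c × c ≤q y (suc t))
crossing y c zero a ya<c c≤ya+0 =
  ⊥-elim (ℚP.<-irrefl refl (ℚP.<-≤-trans ya<c (subst (λ s → c ≤q y s) (ℕP.+-identityʳ a) c≤ya+0)))
crossing y c (suc l) a ya<c c≤y[a+1+l] with c ℚP.≤? y (suc a)
... | yes c≤ya+1 = a , ℕP.≤-refl , ℕP.m<m+n a (s≤s z≤n) , ya<c , c≤ya+1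
... | no c≰ya+1 with crossing y c l (suc a) (ℚP.≰⇒> c≰ya+1) (subst (λ s → c ≤q y s) (ℕP.+-suc a l) c≤y[a+1+l])
...   | t , a<t , t<a+1+l , yt<c , c≤yt+1 =
  t , ℕP.<⇒≤ a<t , subst (t <_) (sym (ℕP.+-suc a l)) t<a+1+l , yt<c , c≤yt+1

module _ {nP nG : ℕ} (grp : Fin nP → Fin nG) (x : Fin nP → ℕ → ℚ) where

  private
    inGroup : Fin nG → (Fin nP → ℚ) → Fin nP → ℚ
    inGroup g f q = if does (grp q ≟F g) then f q else 0ℚ

    inGroup-+ : ∀ g f h q → inGroup g (λ q → f q +q h q) q ≡ inGroup g f q +q inGroup g h q
    inGroup-+ g f h q with grp q ≟F g
    ... | yes _ = refl
    ... | no  _ = refl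

    inGroup-self : ∀ f p → inGroup (grp p) f p ≡ f p
    inGroup-self f p with grp p ≟F grp p
    ... | yes _   = refl
    ... | no  g≢g = ⊥-elim (g≢g refl)

    inGroup-others : ∀ f p → (∀ q → grp q ≡ grp p → q ≢ p → f q ≡ 0ℚ) →
                     ∀ q → q ≢ p → inGroup (grp p) f q ≡ 0ℚ
    inGroup-others f p others≡0 q q≢p with grp q ≟F grp p
    ... | yes same = others≡0 q same q≢p
    ... | no  _    = refl

  yStar-step : ∀ p t → (∀ q → grp q ≡ grp p → q ≢ p → x q (suc t) ≡ 0ℚ) →
               yStar grp x (grp p) (suc t) ≡ yStar grp x (grp p) t +q x p (suc t)
  yStar-step p t others≡0 = begin
    sumFin nP (inGroup g (λ q → sumTo (x q) t +q x q (suc t)))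
      ≡⟨ sumFin-cong nP (inGroup-+ g (λ q → sumTo (x q) t) (λ q → x q (suc t))) ⟩
    sumFin nP (λ q → inGroup g (λ q → sumTo (x q) t) q +q inGroup g (λ q → x q (suc t)) q)
      ≡⟨ sumFin-distrib-+ nP _ _ ⟩
    yStar grp x g t +q sumFin nP (inGroup g (λ q → x q (suc t)))
      ≡⟨ cong (yStar grp x g t +q_) (sumFin-single nP _ p (inGroup-others (λ q → x q (suc t)) p others≡0)) ⟩
    yStar grp x g t +q inGroup g (λ q → x q (suc t)) p
      ≡⟨ cong (yStar grp x g t +q_) (inGroup-self (λ q → x q (suc t)) p) ⟩
    yStar grp x g t +q x p (suc t) ∎
    where
    open ≡-Reasoning
    g : Fin nG
    g = grp p

module _ {nP nR nG : ℕ} {page : Fin nR → Fin nP} {rel : Fin nR → ℕ} {L T : ℕ}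
         {x : Fin nP → ℕ → ℚ} {grp : Fin nP → Fin nG}
         (lp : LPFeasible page rel L T x) (disjoint : GroupsDisjoint page rel L grp) where

  private
    zero-outside-horizon : ∀ p t → (t ≡ 0 ⊎ T < t) → x p t ≡ 0ℚ
    zero-outside-horizon = proj₁ (proj₂ lp)

    covers : ∀ ρ → 1ℚ ≤q sumRange (x (page ρ)) (rel ρ) L
    covers = proj₁ (proj₂ (proj₂ lp))

    zero-outside-window : ∀ p t → 1 ≤ t → t ≤ T → ¬ InWindow page rel L p t → x p t ≡ 0ℚ
    zero-outside-window = proj₂ (proj₂ (proj₂ (proj₂ lp)))

  others-vanish-in-window : ∀ ρ t → rel ρ < t → t ≤ rel ρ + L →
    ∀ q → grp q ≡ grp (page ρ) → q ≢ page ρ → x q t ≡ 0ℚ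
  others-vanish-in-window ρ t r<t t≤r+L q same q≢p with t ≤? T
  ... | yes t≤T = zero-outside-window q t (ℕP.≤-trans (s≤s z≤n) r<t) t≤T
                    (λ q-in → disjoint q (page ρ) same q≢p t (q-in , ρ-in))
    where
    ρ-in : InWindow page rel L (page ρ) t
    ρ-in = ρ , ρ , refl , refl , subst (_≤ t) (ℕP.+-comm 1 (rel ρ)) r<t , t≤r+L
  ... | no  t≰T = zero-outside-horizon q t (inj₂ (ℕP.≰⇒> t≰T))

  yStar-crosses-in-window : ∀ ρ c →
    let y = yStar grp x (grp (page ρ)) in
    y (rel ρ) <q c → c ≤q y (rel ρ) +q 1ℚ →
    ∃[ t ] (rel ρ ≤ t × t < rel ρ + L × y t <q c × c ≤q y (suc t) × 0ℚ <q x (page ρ) (suc t))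
  yStar-crosses-in-window ρ c ya<c c≤ya+1 =
    with-positive-step (crossing y c L a ya<c (ℚP.≤-trans c≤ya+1 ya+1≤y[a+L]))
    where
    p : Fin nP
    p = page ρ
    a : ℕ
    a = rel ρ
    y : ℕ → ℚ
    y = yStar grp x (grp p)

    step : ∀ t → a ≤ t → t < a + L → y (suc t) ≡ y t +q x p (suc t)
    step t a≤t t<a+L = yStar-step grp x p t (others-vanish-in-window ρ (suc t) (s≤s a≤t) t<a+L)

    ya+1≤y[a+L] : y a +q 1ℚ ≤q y (a + L)
    ya+1≤y[a+L] = ℚP.≤-trans (ℚP.+-monoʳ-≤ (y a) (covers ρ))
                    (ℚP.≤-reflexive (sym (telescope y (x p) L a step)))

    with-positive-step : ∃[ t ] (a ≤ t × t < a + L × y t <q c × c ≤q y (suc t)) →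
      ∃[ t ] (a ≤ t × t < a + L × y t <q c × c ≤q y (suc t) × 0ℚ <q x p (suc t))
    with-positive-step (t , a≤t , t<a+L , yt<c , c≤y[t+1]) =
      t , a≤t , t<a+L , yt<c , c≤y[t+1] ,
      crossing⇒0<increment (y t) (x p (suc t)) c yt<c (subst (c ≤q_) (step t a≤t t<a+L) c≤y[t+1])

proposition3 : (nP nR nG T L : ℕ) (page : Fin nR → Fin nP) (rel : Fin nR → ℕ) →
    IsOptMaxFlow page rel L →
    ConsecutiveGap page rel L →
    (x : Fin nP → ℕ → ℚ) → LPFeasible page rel L T x →
    (grp : Fin nP → Fin nG) → GroupsDisjoint page rel L grp →
    (α : Fin nG → ℚ) → (∀ g → 0ℚ ≤q α g × α g ≤q 1ℚ) →
    ∀ ρ → ∃[ t ] (rel ρ < t × t ≤ rel ρ + L × TempTransmits grp x α (page ρ) t)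
proposition3 nP nR nG T L page rel _ _ x lp grp disjoint α _ ρ
  with ∃-shifted-integer-in-unit-interval (yStar grp x (grp (page ρ)) (rel ρ)) (α (grp (page ρ)))
... | k , y<c , c≤y+1 with yStar-crosses-in-window lp disjoint ρ _ y<c c≤y+1
...   | t , r≤t , t<r+L , yt<c , c≤y[t+1] , 0<x =
  suc t , s≤s r≤t , t<r+L , (k , yt<c , c≤y[t+1]) , 0<x
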